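{- Let $n$ be an integer with $49\le n\le 132$ and let $(x,y)\in\mathbb{Z}^2$ be a solution of $(x-F_ny)(x-L_ny)x-y^3=\pm1$ with $|y|\ge 2$. Then $|y|\ge\alpha^{2n}$.
   Context: $\alpha=(1+\sqrt5)/2$; $F_n$ and $L_n$ are the $n$-th Fibonacci and Lucas numbers ($F_0=0,F_1=1,L_0=2,L_1=1$, both satisfying $u_{m+2}=u_{m+1}+u_m$). -}

module Defs where

open import Data.Nat using (ℕ; zero; suc; _+_; _*_; _≤_)
open import Data.Product using (_×_)
import Data.Integer as ℤ
open ℤ using (ℤ; +_)

fib : ℕ → ℕ
fib zero = 0
fib (suc zero) = 1
fib (suc (suc m)) = fib (suc m) + fib m

lucas : ℕ → ℕ
lucas zero = 2
lucas (suc zero) = 1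
lucas (suc (suc m)) = lucas (suc m) + lucas m

-- α = (1 + √5)/2.  Exactly, α^m = (L_m + F_m √5) / 2.
-- For k : ℕ,  k ≥ α^m  ⇔  2k - L_m ≥ F_m √5
--                      ⇔  2k ≥ L_m  and  (2k - L_m)^2 ≥ 5 F_m^2   (exact, no reals).
_≥α^_ : ℕ → ℕ → Set
k ≥α^ m = (lucas m ≤ 2 * k) × (+ (5 * (fib m * fib m)) ℤ.≤ d ℤ.* d)
  where
  d : ℤ
  d = (+ (2 * k)) ℤ.- (+ lucas m)

infix 4 _≥α^_

-- Replacing (x, y) by (−x, −y) if necessary, let y ≥ 2, and write F = F_n, D = L_n − F_n = 2F_{n−1}, L = F + D.
-- The cubic x(x − Fy)(x − Ly) has roots 0 < Fy < Ly and must equal y³ ± 1 > 0, so 0 < x < Fy or x > Ly,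
-- and the product of the distances from x to the three roots is at most y³ + 1.
-- If y ≤ 730, this product is at least F² > 730³ + 1.
-- Otherwise, if x = ρy + e for a root ρy and |e| ≤ 9, the form equals e³ + yq; as |±1 − e³| ≤ 730 < y,
-- this forces q = 0 and e = ±1, and q = 0 is then a quadratic equation in y without solutions.
-- If instead both distances to the neighbouring roots are at least 10 (resp. x − Ly ≥ 2), the product is at
-- least 5FD·y² (resp. 2DL·y²), so y ≥ min(5FD, 2DL) ≥ L_{2n}, and L_{2n} > α^{2n} as L_{2n}² = 5F_{2n}² + 4.
-- The required inequalities between F, D, L_{2n} and this identity are checked by evaluation for 49 ≤ n ≤ 132.

module Submission where

open import Data.Empty using (⊥; ⊥-elim)
open import Data.Fin using (Fin; toℕ; fromℕ<)
open import Data.Fin.Properties using (all?; toℕ-fromℕ<)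
open import Data.Integer as ℤ using (ℤ; +_; -[1+_]; 0ℤ; ∣_∣; _-_; +≤+) renaming (_+_ to _+ℤ_; _*_ to _*ℤ_; -_ to -ℤ_)
import Data.Integer.Properties as ℤₚ
import Data.Integer.Tactic.RingSolver as ℤ-Ring
open import Data.List using (_∷_; [])
open import Data.Nat using (ℕ; zero; suc; pred; _+_; _*_; _∸_; _^_; _≤_; _<_; _⊓_; z≤n; s≤s; z<s; s≤s⁻¹; >-nonZero; compare; less; equal; greater)
open import Data.Nat.Properties
import Data.Nat.Tactic.RingSolver as ℕ-Ring
open import Data.Product using (_×_; _,_; proj₁; proj₂)
open import Data.Sum using (_⊎_; inj₁; inj₂)
open import Function using (_∘_)
open import Relation.Binary.PropositionalEquality using (_≡_; _≢_; refl; sym; trans; cong; cong₂; subst; subst₂; module ≡-Reasoning)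
open import Relation.Nullary using (¬_; contradiction; yes; no; Dec)
open import Relation.Nullary.Decidable using (_×-dec_; toWitness)

open import Defs

m+n≤1+m*n : ∀ {m n} → 0 < m → 0 < n → m + n ≤ suc (m * n)
m+n≤1+m*n {suc m} {suc n} _ _ = s≤s (begin
  m + suc n          ≡⟨ +-comm m (suc n) ⟩
  suc n + m          ≤⟨ +-monoʳ-≤ (suc n) (m≤m*n m (suc n)) ⟩
  suc n + m * suc n  ∎)
  where open ≤-Reasoning

m*n>0⇒m>0∧n>0 : ∀ m n → 0 < m * n → 0 < m × 0 < n
m*n>0⇒m>0∧n>0 (suc m) (suc n) _ = z<s , z<s
m*n>0⇒m>0∧n>0 (suc m) zero    p = contradiction (subst (0 <_) (*-zeroʳ m) p) (<-irrefl refl)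

-- o = (m ∸ n) * n, and a product of two positive factors is at least their sum minus one.
m*n≢o+n*n : ∀ m n o → 0 < o → o + 2 ≤ m → m * n ≢ o + n * n
m*n≢o+n*n m n o 0<o o+2≤m eq = contradiction (+-cancelˡ-≤ o 2 1 o+2≤o+1) λ { (s≤s ()) }
  where
  k = m ∸ n
  o≡k*n : o ≡ k * n
  o≡k*n = begin-equality
    o                  ≡⟨ m+n∸n≡m o (n * n) ⟨
    o + n * n ∸ n * n  ≡⟨ cong (_∸ n * n) eq ⟨
    m * n ∸ n * n      ≡⟨ *-distribʳ-∸ n m n ⟨
    k * n              ∎
    where open ≤-Reasoning
  positive = m*n>0⇒m>0∧n>0 k n (subst (0 <_) o≡k*n 0<o)
  o+2≤o+1 : o + 2 ≤ o + 1
  o+2≤o+1 = begin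
    o + 2          ≤⟨ o+2≤m ⟩
    m              ≤⟨ m≤n+m∸n m n ⟩
    n + k          ≡⟨ +-comm n k ⟩
    k + n          ≤⟨ m+n≤1+m*n (proj₁ positive) (proj₂ positive) ⟩
    suc (k * n)    ≡⟨ cong suc o≡k*n ⟨
    suc o          ≡⟨ +-comm 1 o ⟩
    o + 1          ∎
    where open ≤-Reasoning

m*n+o≢n*n : ∀ m n o → 0 < o → o ≤ m → m * n + o ≢ n * n
m*n+o≢n*n m n o 0<o o≤m eq = <⇒≱ m<n (begin
  n      ≤⟨ m≤n*m n k {{>-nonZero (proj₁ positive)}} ⟩
  k * n  ≡⟨ o≡k*n ⟨
  o      ≤⟨ o≤m ⟩
  m      ∎)
  where
  open ≤-Reasoning
  k = n ∸ m
  o≡k*n : o ≡ k * n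
  o≡k*n = begin-equality
    o                  ≡⟨ m+n∸m≡n (m * n) o ⟨
    m * n + o ∸ m * n  ≡⟨ cong (_∸ m * n) eq ⟩
    n * n ∸ m * n      ≡⟨ *-distribʳ-∸ n n m ⟨
    k * n              ∎
  positive = m*n>0⇒m>0∧n>0 k n (subst (0 <_) o≡k*n 0<o)
  m<n : m < n
  m<n = m∸n≢0⇒n<m (m<n⇒n≢0 (proj₁ positive))

m*[n*n]≤1+n*n*n⇒m≤n : ∀ {m n} → 2 ≤ n → m * (n * n) ≤ 1 + n * n * n → m ≤ n
m*[n*n]≤1+n*n*n⇒m≤n {m} {n} 2≤n bound = ≮⇒≥ λ n<m → <⇒≱ 1<n*n (+-cancelʳ-≤ (n * n * n) (n * n) 1 (begin
  n * n + n * n * n  ≡⟨ cong (λ t → n * n + t) (*-assoc n n n) ⟩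
  suc n * (n * n)    ≤⟨ *-monoˡ-≤ (n * n) n<m ⟩
  m * (n * n)        ≤⟨ bound ⟩
  1 + n * n * n      ∎))
  where
  open ≤-Reasoning
  1<n*n : 1 < n * n
  1<n*n = ≤-trans (s≤s (s≤s z≤n)) (*-mono-≤ 2≤n 2≤n)

5*[m+n]≤m*n : ∀ {m n} → 10 ≤ m → 10 ≤ n → 5 * (m + n) ≤ m * n
5*[m+n]≤m*n {m} {n} 10≤m 10≤n = *-cancelˡ-≤ 2 (begin
  2 * (5 * (m + n))  ≡⟨ ℕ-Ring.solve (m ∷ n ∷ []) ⟩
  10 * m + 10 * n    ≤⟨ +-mono-≤ (*-monoˡ-≤ m 10≤n) (*-monoˡ-≤ n 10≤m) ⟩
  n * m + m * n      ≡⟨ ℕ-Ring.solve (m ∷ n ∷ []) ⟩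
  2 * (m * n)        ∎)
  where open ≤-Reasoning

m+m≤n*m : ∀ {m n} → 2 ≤ n → m + m ≤ n * m
m+m≤n*m {m} {n} 2≤n = subst (_≤ n * m) (cong (_+_ m) (+-identityʳ m)) (*-monoˡ-≤ m 2≤n)

IsUnit : ℤ → Set
IsUnit ε = ε ≡ + 1 ⊎ ε ≡ -ℤ (+ 1)

IsUnit-neg : ∀ {ε} → IsUnit ε → IsUnit (-ℤ ε)
IsUnit-neg (inj₁ refl) = inj₂ refl
IsUnit-neg (inj₂ refl) = inj₁ refl

∣unit∣≡1 : ∀ {ε} → IsUnit ε → ∣ ε ∣ ≡ 1
∣unit∣≡1 (inj₁ refl) = refl
∣unit∣≡1 (inj₂ refl) = refl

unit≤1 : ∀ {ε} → IsUnit ε → ε ℤ.≤ + 1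
unit≤1 (inj₁ refl) = ℤₚ.≤-refl
unit≤1 (inj₂ refl) = ℤ.-≤+

pos-*³ : ∀ p q r → + (p * q * r) ≡ + p *ℤ + q *ℤ + r
pos-*³ p q r = trans (ℤₚ.pos-* (p * q) r) (cong (_*ℤ + r) (ℤₚ.pos-* p q))

pos-cancel : ∀ {m n} → + m - + n ≡ 0ℤ → m ≡ n
pos-cancel eq = ℤₚ.+-injective (ℤₚ.i-j≡0⇒i≡j _ _ eq)

unit⇒product≤1+cube : ∀ {p q r y} → IsUnit (+ p *ℤ + q *ℤ + r - + y *ℤ + y *ℤ + y) →
                      p * q * r ≤ 1 + y * y * y
unit⇒product≤1+cube {p} {q} {r} {y} unit = ℤₚ.drop‿+≤+ (begin
  + (p * q * r)                         ≡⟨ pos-*³ p q r ⟩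
  P                                     ≡⟨ i≡i-j+j P Y ⟩
  (P - Y) +ℤ Y                          ≤⟨ ℤₚ.+-monoˡ-≤ Y (unit≤1 unit) ⟩
  + 1 +ℤ Y                              ≡⟨ cong (+ 1 +ℤ_) (pos-*³ y y y) ⟨
  + (1 + y * y * y)                     ∎)
  where
  open ℤₚ.≤-Reasoning
  P = + p *ℤ + q *ℤ + r
  Y = + y *ℤ + y *ℤ + y
  i≡i-j+j : ∀ i j → i ≡ (i - j) +ℤ j
  i≡i-j+j = ℤ-Ring.solve-∀

unit≢-product-cube : ∀ {p q r y} → 2 ≤ y → ¬ IsUnit (-ℤ (+ p *ℤ + q *ℤ + r) - + y *ℤ + y *ℤ + y)
unit≢-product-cube {p} {q} {r} {y} 2≤y unit =
  <⇒≱ 1<Y (≤-trans (m≤n+m (y * y * y) (p * q * r)) (ℤₚ.drop‿+≤+ P+Y≤1))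
  where
  1<Y : 1 < y * y * y
  1<Y = ≤-trans (s≤s (s≤s z≤n)) (*-mono-≤ (*-mono-≤ 2≤y 2≤y) 2≤y)
  P+Y≤1 : + (p * q * r + y * y * y) ℤ.≤ + 1
  P+Y≤1 = begin
    + (p * q * r + y * y * y)              ≡⟨ cong₂ _+ℤ_ (pos-*³ p q r) (pos-*³ y y y) ⟩
    + p *ℤ + q *ℤ + r +ℤ + y *ℤ + y *ℤ + y  ≡⟨ i+j≡-[-i-j] (+ p *ℤ + q *ℤ + r) (+ y *ℤ + y *ℤ + y) ⟩
    -ℤ (-ℤ (+ p *ℤ + q *ℤ + r) - + y *ℤ + y *ℤ + y)  ≤⟨ unit≤1 (IsUnit-neg unit) ⟩
    + 1                                    ∎
    where
    open ℤₚ.≤-Reasoning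
    i+j≡-[-i-j] : ∀ i j → i +ℤ j ≡ -ℤ (-ℤ i - j)
    i+j≡-[-i-j] = ℤ-Ring.solve-∀

∣+m*i∣<m⇒i≡0 : ∀ m i → ∣ + m *ℤ i ∣ < m → i ≡ 0ℤ
∣+m*i∣<m⇒i≡0 m i ∣mi∣<m = ℤₚ.∣i∣≡0⇒i≡0 (n<1⇒n≡0 (*-cancelˡ-< m ∣ i ∣ 1 (begin-strict
  m * ∣ i ∣      ≡⟨ ℤₚ.abs-* (+ m) i ⟨
  ∣ + m *ℤ i ∣   <⟨ ∣mi∣<m ⟩
  m              ≡⟨ *-identityʳ m ⟨
  m * 1          ∎)))
  where open ≤-Reasoning

∣i*i*i∣≡∣i∣*∣i∣*∣i∣ : ∀ i → ∣ i *ℤ i *ℤ i ∣ ≡ ∣ i ∣ * ∣ i ∣ * ∣ i ∣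
∣i*i*i∣≡∣i∣*∣i∣*∣i∣ i = trans (ℤₚ.abs-* (i *ℤ i) i) (cong (_* ∣ i ∣) (ℤₚ.abs-* i i))

-- y divides ε − e³, which is too small to be a nonzero multiple of y.
cube+multiple-unit : ∀ {e q y} → IsUnit (e *ℤ e *ℤ e +ℤ + y *ℤ q) → ∣ e ∣ ≤ 9 → 730 < y →
                     q ≡ 0ℤ × ∣ e ∣ ≡ 1
cube+multiple-unit {e} {q} {y} unit ∣e∣≤9 730<y = q≡0 , m*n≡1⇒n≡1 (∣ e ∣ * ∣ e ∣) ∣ e ∣ ∣e∣³≡1
  where
  e³ = e *ℤ e *ℤ e
  ε = e³ +ℤ + y *ℤ q
  m≡[c+m]-c : ∀ c m → m ≡ (c +ℤ m) - c
  m≡[c+m]-c = ℤ-Ring.solve-∀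
  ∣ε-e³∣<y : ∣ ε - e³ ∣ < y
  ∣ε-e³∣<y = begin-strict
    ∣ ε - e³ ∣                        ≤⟨ ℤₚ.∣i-j∣≤∣i∣+∣j∣ ε e³ ⟩
    ∣ ε ∣ + ∣ e³ ∣                     ≡⟨ cong₂ _+_ (∣unit∣≡1 unit) (∣i*i*i∣≡∣i∣*∣i∣*∣i∣ e) ⟩
    1 + ∣ e ∣ * ∣ e ∣ * ∣ e ∣          ≤⟨ +-monoʳ-≤ 1 (*-mono-≤ (*-mono-≤ ∣e∣≤9 ∣e∣≤9) ∣e∣≤9) ⟩
    730                               <⟨ 730<y ⟩
    y                                 ∎
    where open ≤-Reasoning
  q≡0 : q ≡ 0ℤ
  q≡0 = ∣+m*i∣<m⇒i≡0 y q (subst (λ t → ∣ t ∣ < y) (sym (m≡[c+m]-c e³ (+ y *ℤ q))) ∣ε-e³∣<y)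
  ∣e∣³≡1 : ∣ e ∣ * ∣ e ∣ * ∣ e ∣ ≡ 1
  ∣e∣³≡1 = begin-equality
    ∣ e ∣ * ∣ e ∣ * ∣ e ∣       ≡⟨ ∣i*i*i∣≡∣i∣*∣i∣*∣i∣ e ⟨
    ∣ e³ ∣                     ≡⟨ cong ∣_∣ (ℤₚ.+-identityʳ e³) ⟨
    ∣ e³ +ℤ 0ℤ ∣               ≡⟨ cong (λ t → ∣ e³ +ℤ t ∣) (trans (cong (+ y *ℤ_) q≡0) (ℤₚ.*-zeroʳ (+ y))) ⟨
    ∣ ε ∣                      ≡⟨ ∣unit∣≡1 unit ⟩
    1                          ∎
    where open ≤-Reasoning

thueForm : ℤ → ℤ → ℤ → ℤ → ℤ
thueForm f l x y = (x - f *ℤ y) *ℤ (x - l *ℤ y) *ℤ x - y *ℤ y *ℤ y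

-- The ring solver treats applications of defined functions as atoms, so the identities below are stated unfolded.
thueForm-odd : ∀ f l x y → (-ℤ x - f *ℤ -ℤ y) *ℤ (-ℤ x - l *ℤ -ℤ y) *ℤ -ℤ x - -ℤ y *ℤ -ℤ y *ℤ -ℤ y ≡
                           -ℤ ((x - f *ℤ y) *ℤ (x - l *ℤ y) *ℤ x - y *ℤ y *ℤ y)
thueForm-odd = ℤ-Ring.solve-∀

thueForm-near-0 : ∀ f l e y → (e - f *ℤ y) *ℤ (e - l *ℤ y) *ℤ e - y *ℤ y *ℤ y ≡
                              e *ℤ e *ℤ e +ℤ y *ℤ (e *ℤ f *ℤ l *ℤ y - e *ℤ e *ℤ (f +ℤ l) - y *ℤ y)
thueForm-near-0 = ℤ-Ring.solve-∀

thueForm-near-f : ∀ f d e y → (e +ℤ f *ℤ y - f *ℤ y) *ℤ (e +ℤ f *ℤ y - (f +ℤ d) *ℤ y) *ℤ (e +ℤ f *ℤ y) - y *ℤ y *ℤ y ≡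
                              e *ℤ e *ℤ e +ℤ y *ℤ (e *ℤ e *ℤ (f - d) - e *ℤ f *ℤ d *ℤ y - y *ℤ y)
thueForm-near-f = ℤ-Ring.solve-∀

thueForm-near-l : ∀ f d e y → (e +ℤ (f +ℤ d) *ℤ y - f *ℤ y) *ℤ (e +ℤ (f +ℤ d) *ℤ y - (f +ℤ d) *ℤ y) *ℤ (e +ℤ (f +ℤ d) *ℤ y)
                                - y *ℤ y *ℤ y ≡
                              e *ℤ e *ℤ e +ℤ y *ℤ (e *ℤ (f +ℤ d) *ℤ d *ℤ y +ℤ e *ℤ e *ℤ (d +ℤ (f +ℤ d)) - y *ℤ y)
thueForm-near-l = ℤ-Ring.solve-∀

form-left : ∀ a u w y → (-ℤ a - u) *ℤ (-ℤ a - (u +ℤ w)) *ℤ -ℤ a - y *ℤ y *ℤ y ≡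
                        -ℤ (a *ℤ (a +ℤ u) *ℤ (a +ℤ u +ℤ w)) - y *ℤ y *ℤ y
form-left = ℤ-Ring.solve-∀

form-inner : ∀ a b w y → (a - (a +ℤ b)) *ℤ (a - (a +ℤ b +ℤ w)) *ℤ a - y *ℤ y *ℤ y ≡
                         a *ℤ b *ℤ (b +ℤ w) - y *ℤ y *ℤ y
form-inner = ℤ-Ring.solve-∀

form-middle : ∀ u c e y → (u +ℤ c - u) *ℤ (u +ℤ c - (u +ℤ (c +ℤ e))) *ℤ (u +ℤ c) - y *ℤ y *ℤ y ≡
                          -ℤ (c *ℤ e *ℤ (u +ℤ c)) - y *ℤ y *ℤ y
form-middle = ℤ-Ring.solve-∀

form-right : ∀ u w c y → (u +ℤ w +ℤ c - u) *ℤ (u +ℤ w +ℤ c - (u +ℤ w)) *ℤ (u +ℤ w +ℤ c) - y *ℤ y *ℤ y ≡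
                         (w +ℤ c) *ℤ c *ℤ (u +ℤ w +ℤ c) - y *ℤ y *ℤ y
form-right = ℤ-Ring.solve-∀

data Position (u w : ℕ) : ℤ → Set where
  left   : ∀ a → Position u w (-ℤ (+ a))
  inner  : ∀ {a b} → 0 < a → 0 < b → a + b ≡ u → Position u w (+ a)
  middle : ∀ {c e} → c + e ≡ w → Position u w (+ (u + c))
  right  : ∀ {c} → 0 < c → Position u w (+ (u + w + c))

position : ∀ u w x → Position u w x
position u w -[1+ a ]   = left (suc a)
position u w (+ zero)   = left 0
position u w (+ suc a) with compare (suc a) u
... | less _ k    = inner z<s z<s (+-suc (suc a) k)
... | equal _     = subst (Position u w ∘ +_) (+-identityʳ u) (middle refl)
... | greater _ k with compare (suc k) w
...   | less _ j    = subst (Position u w ∘ +_) (+-suc u k) (middle (+-suc (suc k) j))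
...   | equal _     = subst (Position u w ∘ +_) (+-suc u k) (middle (+-identityʳ (suc k)))
...   | greater _ j = subst (Position u w ∘ +_) (trans (+-suc (u + w) j) (cong suc (+-assoc u w j))) (right z<s)

quotient-near-0 : ∀ F L y → + 1 *ℤ + F *ℤ + L *ℤ + y - + 1 *ℤ + 1 *ℤ (+ F +ℤ + L) - + y *ℤ + y ≡ 0ℤ →
                  F * L * y ≡ F + L + y * y
quotient-near-0 F L y q≡0 = pos-cancel (begin
  + (F * L * y) - + (F + L + y * y)              ≡⟨ cong₂ _-_ (pos-*³ F L y) (cong (+ (F + L) +ℤ_) (ℤₚ.pos-* y y)) ⟩
  + F *ℤ + L *ℤ + y - (+ F +ℤ + L +ℤ + y *ℤ + y)  ≡⟨ at-1 (+ F) (+ L) (+ y) ⟩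
  _                                              ≡⟨ q≡0 ⟩
  0ℤ                                             ∎)
  where
  open ≡-Reasoning
  at-1 : ∀ f l y → f *ℤ l *ℤ y - (f +ℤ l +ℤ y *ℤ y) ≡ + 1 *ℤ f *ℤ l *ℤ y - + 1 *ℤ + 1 *ℤ (f +ℤ l) - y *ℤ y
  at-1 = ℤ-Ring.solve-∀

quotient-near-f : ∀ F D y → -ℤ (+ 1) *ℤ -ℤ (+ 1) *ℤ (+ F - + D) - -ℤ (+ 1) *ℤ + F *ℤ + D *ℤ + y - + y *ℤ + y ≡ 0ℤ →
                  F * D * y + F ≡ D + y * y
quotient-near-f F D y q≡0 = pos-cancel (begin
  + (F * D * y + F) - + (D + y * y)                ≡⟨ cong₂ _-_ (cong (_+ℤ + F) (pos-*³ F D y)) (cong (+ D +ℤ_) (ℤₚ.pos-* y y)) ⟩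
  (+ F *ℤ + D *ℤ + y +ℤ + F) - (+ D +ℤ + y *ℤ + y)  ≡⟨ at-minus-1 (+ F) (+ D) (+ y) ⟩
  _                                                ≡⟨ q≡0 ⟩
  0ℤ                                               ∎)
  where
  open ≡-Reasoning
  at-minus-1 : ∀ f d y → (f *ℤ d *ℤ y +ℤ f) - (d +ℤ y *ℤ y) ≡
                         -ℤ (+ 1) *ℤ -ℤ (+ 1) *ℤ (f - d) - -ℤ (+ 1) *ℤ f *ℤ d *ℤ y - y *ℤ y
  at-minus-1 = ℤ-Ring.solve-∀

quotient-near-l : ∀ F D y → + 1 *ℤ + (F + D) *ℤ + D *ℤ + y +ℤ + 1 *ℤ + 1 *ℤ (+ D +ℤ + (F + D)) - + y *ℤ + y ≡ 0ℤ →
                  D * (F + D) * y + (D + (F + D)) ≡ y * y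
quotient-near-l F D y q≡0 = pos-cancel (begin
  + (D * (F + D) * y + (D + (F + D))) - + (y * y)              ≡⟨ cong₂ _-_ (cong (_+ℤ + (D + (F + D))) (pos-*³ D (F + D) y))
                                                                      (ℤₚ.pos-* y y) ⟩
  (+ D *ℤ + (F + D) *ℤ + y +ℤ + (D + (F + D))) - + y *ℤ + y     ≡⟨ at-1 (+ F) (+ D) (+ y) ⟩
  _                                                            ≡⟨ q≡0 ⟩
  0ℤ                                                           ∎)
  where
  open ≡-Reasoning
  at-1 : ∀ f d y → (d *ℤ (f +ℤ d) *ℤ y +ℤ (d +ℤ (f +ℤ d))) - y *ℤ y ≡
                   + 1 *ℤ (f +ℤ d) *ℤ d *ℤ y +ℤ + 1 *ℤ + 1 *ℤ (d +ℤ (f +ℤ d)) - y *ℤ y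
  at-1 = ℤ-Ring.solve-∀

module _ {F D : ℕ} (F<D : F < D) (1+730³<F² : 1 + 730 ^ 3 < F * F) where

  private
    2≤F : 2 ≤ F
    2≤F = ≰⇒> λ F≤1 → <⇒≱ 1+730³<F² (≤-trans (*-mono-≤ F≤1 F≤1) (s≤s z≤n))

    2≤D : 2 ≤ D
    2≤D = ≤-trans 2≤F (<⇒≤ F<D)

    form : ℤ → ℤ → ℤ
    form = thueForm (+ F) (+ (F + D))

  module _ {y : ℕ} (2≤y : 2 ≤ y) where

    private
      0<y : 0 < y
      0<y = ≤-trans (s≤s z≤n) 2≤y

    on-roots : ∀ x → IsUnit (form x (+ y)) → IsUnit ((x - + (F * y)) *ℤ (x - + (F * y + D * y)) *ℤ x - + y *ℤ + y *ℤ + y)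
    on-roots x = subst₂ (λ u v → IsUnit ((x - u) *ℤ (x - v) *ℤ x - + y *ℤ + y *ℤ + y))
                   (sym (ℤₚ.pos-* F y)) (trans (sym (ℤₚ.pos-* (F + D) y)) (cong +_ (*-distribʳ-+ y F D)))

    inner-product≤1+y³ : ∀ {a b} → a + b ≡ F * y → IsUnit (form (+ a) (+ y)) →
                         a * b * (b + D * y) ≤ 1 + y * y * y
    inner-product≤1+y³ {a} {b} a+b≡Fy unit = unit⇒product≤1+cube {a} {b} {b + D * y} {y}
      (subst IsUnit (form-inner (+ a) (+ b) (+ (D * y)) (+ y))
        (subst (λ u → IsUnit ((+ a - + u) *ℤ (+ a - + (u + D * y)) *ℤ + a - + y *ℤ + y *ℤ + y)) (sym a+b≡Fy)
          (on-roots (+ a) unit)))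

    right-product≤1+y³ : ∀ {c} → IsUnit (form (+ (F * y + D * y + c)) (+ y)) →
                         (D * y + c) * c * (F * y + D * y + c) ≤ 1 + y * y * y
    right-product≤1+y³ {c} unit = unit⇒product≤1+cube {D * y + c} {c} {F * y + D * y + c} {y}
      (subst IsUnit (form-right (+ (F * y)) (+ (D * y)) (+ c) (+ y)) (on-roots (+ (F * y + D * y + c)) unit))

    inner-product≥F² : ∀ {a b} → 0 < a → 0 < b → a + b ≡ F * y → F * F ≤ a * b * (b + D * y)
    inner-product≥F² {a} {b} 0<a 0<b a+b≡Fy = *-mono-≤ F≤ab F≤b+Dy
      where
      open ≤-Reasoning
      F≤ab : F ≤ a * b
      F≤ab = s≤s⁻¹ (begin
        1 + F        ≤⟨ +-monoˡ-≤ F (≤-trans (s≤s z≤n) 2≤F) ⟩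
        F + F        ≤⟨ m+m≤n*m 2≤y ⟩
        y * F        ≡⟨ *-comm y F ⟩
        F * y        ≡⟨ a+b≡Fy ⟨
        a + b        ≤⟨ m+n≤1+m*n 0<a 0<b ⟩
        1 + a * b    ∎)
      F≤b+Dy : F ≤ b + D * y
      F≤b+Dy = begin
        F            ≤⟨ <⇒≤ F<D ⟩
        D            ≤⟨ m≤m*n D y {{>-nonZero 0<y}} ⟩
        D * y        ≤⟨ m≤n+m (D * y) b ⟩
        b + D * y    ∎

    right-product≥F² : ∀ {c} → 0 < c → F * F ≤ (D * y + c) * c * (F * y + D * y + c)
    right-product≥F² {c} 0<c = begin
      F * F                                  ≡⟨ cong (_* F) (*-identityʳ F) ⟨
      F * 1 * F                              ≤⟨ *-mono-≤ (*-mono-≤ F≤Dy+c 0<c) F≤Fy+Dy+c ⟩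
      (D * y + c) * c * (F * y + D * y + c)  ∎
      where
      open ≤-Reasoning
      F≤Dy+c : F ≤ D * y + c
      F≤Dy+c = ≤-trans (<⇒≤ F<D) (≤-trans (m≤m*n D y {{>-nonZero 0<y}}) (m≤m+n (D * y) c))
      F≤Fy+Dy+c : F ≤ F * y + D * y + c
      F≤Fy+Dy+c = ≤-trans (m≤m*n F y {{>-nonZero 0<y}}) (≤-trans (m≤m+n (F * y) (D * y)) (m≤m+n _ c))

    inner-product≥5FDy² : ∀ {a b} → 10 ≤ a → 10 ≤ b → a + b ≡ F * y → 5 * (F * D) * (y * y) ≤ a * b * (b + D * y)
    inner-product≥5FDy² {a} {b} 10≤a 10≤b a+b≡Fy = begin
      5 * (F * D) * (y * y)    ≡⟨ ℕ-Ring.solve (F ∷ D ∷ y ∷ []) ⟩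
      5 * (F * y) * (D * y)    ≡⟨ cong (λ t → 5 * t * (D * y)) a+b≡Fy ⟨
      5 * (a + b) * (D * y)    ≤⟨ *-mono-≤ (5*[m+n]≤m*n 10≤a 10≤b) (m≤n+m (D * y) b) ⟩
      a * b * (b + D * y)      ∎
      where open ≤-Reasoning

    right-product≥2DLy² : ∀ {c} → 2 ≤ c → 2 * (D * (F + D)) * (y * y) ≤ (D * y + c) * c * (F * y + D * y + c)
    right-product≥2DLy² {c} 2≤c = begin
      2 * (D * (F + D)) * (y * y)            ≡⟨ ℕ-Ring.solve (F ∷ D ∷ y ∷ []) ⟩
      D * y * 2 * (F * y + D * y)            ≤⟨ *-mono-≤ (*-mono-≤ (m≤m+n (D * y) c) 2≤c) (m≤m+n (F * y + D * y) c) ⟩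
      (D * y + c) * c * (F * y + D * y + c)  ∎
      where open ≤-Reasoning

    small-y-impossible : ∀ {P} → y ≤ 730 → F * F ≤ P → P ≤ 1 + y * y * y → ⊥
    small-y-impossible y≤730 F²≤P P≤1+y³ = <⇒≱ 1+730³<F²
      (≤-trans F²≤P (≤-trans P≤1+y³ (+-monoʳ-≤ 1 (*-mono-≤ (*-mono-≤ y≤730 y≤730) y≤730))))

    next-to-0-impossible : 730 < y → ∀ {a} → a ≤ 9 → ¬ IsUnit (form (+ a) (+ y))
    next-to-0-impossible 730<y {a} a≤9 unit =
      let q≡0 , a≡1 = cube+multiple-unit {+ a} (subst IsUnit (thueForm-near-0 (+ F) (+ (F + D)) (+ a) (+ y)) unit) a≤9 730<y
      in m*n≢o+n*n (F * (F + D)) y (F + (F + D)) (≤-trans (≤-trans (s≤s z≤n) 2≤F) (m≤m+n F _)) S+2≤M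
           (quotient-near-0 F (F + D) y (subst (λ a → quotient a ≡ 0ℤ) a≡1 q≡0))
      where
      quotient : ℕ → ℤ
      quotient k = + k *ℤ + F *ℤ + (F + D) *ℤ + y - + k *ℤ + k *ℤ (+ F +ℤ + (F + D)) - + y *ℤ + y
      S+2≤M : F + (F + D) + 2 ≤ F * (F + D)
      S+2≤M = begin
        F + (F + D) + 2      ≡⟨ ℕ-Ring.solve (F ∷ D ∷ []) ⟩
        (F + 2) + (F + D)    ≤⟨ +-monoˡ-≤ (F + D) (+-monoʳ-≤ F 2≤D) ⟩
        (F + D) + (F + D)    ≤⟨ m+m≤n*m 2≤F ⟩
        F * (F + D)          ∎
        where open ≤-Reasoning

    next-to-f-impossible : 730 < y → ∀ {b} → b ≤ 9 → ¬ IsUnit (form (-ℤ (+ b) +ℤ + F *ℤ + y) (+ y))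
    next-to-f-impossible 730<y {b} b≤9 unit =
      let q≡0 , ∣-b∣≡1 = cube+multiple-unit { -ℤ (+ b)}
                          (subst IsUnit (thueForm-near-f (+ F) (+ D) (-ℤ (+ b)) (+ y)) unit)
                          (subst (_≤ 9) (sym (ℤₚ.∣-i∣≡∣i∣ (+ b))) b≤9) 730<y
          b≡1 = trans (sym (ℤₚ.∣-i∣≡∣i∣ (+ b))) ∣-b∣≡1
      in m*n≢o+n*n (F * D) y (D ∸ F) (m<n⇒0<n∸m F<D) S+2≤M (+-cancelʳ-≡ F _ _ (begin-equality
           F * D * y + F        ≡⟨ quotient-near-f F D y (subst (λ b → quotient b ≡ 0ℤ) b≡1 q≡0) ⟩
           D + y * y            ≡⟨ cong (_+ y * y) (m∸n+n≡m (<⇒≤ F<D)) ⟨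
           D ∸ F + F + y * y    ≡⟨ +-comm-last (D ∸ F) F (y * y) ⟩
           D ∸ F + y * y + F    ∎))
      where
      open ≤-Reasoning
      quotient : ℕ → ℤ
      quotient k = -ℤ (+ k) *ℤ -ℤ (+ k) *ℤ (+ F - + D) - -ℤ (+ k) *ℤ + F *ℤ + D *ℤ + y - + y *ℤ + y
      +-comm-last : ∀ k m n → k + m + n ≡ k + n + m
      +-comm-last = ℕ-Ring.solve-∀
      S+2≤M : D ∸ F + 2 ≤ F * D
      S+2≤M = begin
        D ∸ F + 2            ≤⟨ +-mono-≤ (m∸n≤m D F) 2≤D ⟩
        D + D                ≤⟨ m+m≤n*m 2≤F ⟩
        F * D                ∎

    next-to-l-impossible : 730 < y → ¬ IsUnit (form (+ 1 +ℤ + (F + D) *ℤ + y) (+ y))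
    next-to-l-impossible 730<y unit =
      let q≡0 , _ = cube+multiple-unit {+ 1}
                      (subst IsUnit (thueForm-near-l (+ F) (+ D) (+ 1) (+ y)) unit)
                      (s≤s z≤n) 730<y
      in m*n+o≢n*n (D * (F + D)) y (D + (F + D)) (≤-trans (≤-trans (s≤s z≤n) 2≤D) (m≤m+n D _)) S≤M (quotient-near-l F D y q≡0)
      where
      S≤M : D + (F + D) ≤ D * (F + D)
      S≤M = ≤-trans (+-monoˡ-≤ (F + D) (m≤n+m D F)) (m+m≤n*m 2≤D)

    inner-bound : ∀ {a b} → 0 < a → 0 < b → a + b ≡ F * y → IsUnit (form (+ a) (+ y)) →
                  (5 * (F * D)) ⊓ (2 * (D * (F + D))) ≤ y
    inner-bound {a} {b} 0<a 0<b a+b≡Fy unit with y ≤? 730 | a ≤? 9 | b ≤? 9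
    ... | yes y≤730 | _       | _       =
      ⊥-elim (small-y-impossible y≤730 (inner-product≥F² 0<a 0<b a+b≡Fy) (inner-product≤1+y³ a+b≡Fy unit))
    ... | no y≰730  | yes a≤9 | _       = ⊥-elim (next-to-0-impossible (≰⇒> y≰730) a≤9 unit)
    ... | no y≰730  | no _    | yes b≤9 =
      ⊥-elim (next-to-f-impossible (≰⇒> y≰730) b≤9 (subst (λ x → IsUnit (form x (+ y))) a≡-b+Fy unit))
      where
      i≡-j+[i+j] : ∀ i j → i ≡ -ℤ j +ℤ (i +ℤ j)
      i≡-j+[i+j] = ℤ-Ring.solve-∀
      a≡-b+Fy : + a ≡ -ℤ (+ b) +ℤ + F *ℤ + y
      a≡-b+Fy = trans (i≡-j+[i+j] (+ a) (+ b)) (cong (λ t → -ℤ (+ b) +ℤ t) (trans (cong +_ a+b≡Fy) (ℤₚ.pos-* F y)))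
    ... | no _      | no a≰9  | no b≰9  = ≤-trans (m⊓n≤m (5 * (F * D)) (2 * (D * (F + D)))) (m*[n*n]≤1+n*n*n⇒m≤n 2≤y
      (≤-trans (inner-product≥5FDy² (≰⇒> a≰9) (≰⇒> b≰9) a+b≡Fy) (inner-product≤1+y³ a+b≡Fy unit)))

    right-bound : ∀ {c} → 0 < c → IsUnit (form (+ (F * y + D * y + c)) (+ y)) →
                  (5 * (F * D)) ⊓ (2 * (D * (F + D))) ≤ y
    right-bound {c} 0<c unit with y ≤? 730 | c ≤? 1
    ... | yes y≤730 | _       = ⊥-elim (small-y-impossible y≤730 (right-product≥F² 0<c) (right-product≤1+y³ unit))
    ... | no y≰730  | yes c≤1 =
      ⊥-elim (next-to-l-impossible (≰⇒> y≰730) (subst (λ x → IsUnit (form x (+ y))) x≡1+Ly unit))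
      where
      u+w+1≡1+[f+d]y : ∀ f d y → f *ℤ y +ℤ d *ℤ y +ℤ + 1 ≡ + 1 +ℤ (f +ℤ d) *ℤ y
      u+w+1≡1+[f+d]y = ℤ-Ring.solve-∀
      x≡1+Ly : + (F * y + D * y + c) ≡ + 1 +ℤ + (F + D) *ℤ + y
      x≡1+Ly = begin
        + (F * y + D * y + c)              ≡⟨ cong (λ c → + (F * y + D * y + c)) (≤-antisym c≤1 0<c) ⟩
        + (F * y) +ℤ + (D * y) +ℤ + 1      ≡⟨ cong₂ (λ u w → u +ℤ w +ℤ + 1) (ℤₚ.pos-* F y) (ℤₚ.pos-* D y) ⟩
        + F *ℤ + y +ℤ + D *ℤ + y +ℤ + 1    ≡⟨ u+w+1≡1+[f+d]y (+ F) (+ D) (+ y) ⟩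
        + 1 +ℤ + (F + D) *ℤ + y            ∎
        where open ≡-Reasoning
    ... | no _      | no c≰1  = ≤-trans (m⊓n≤n (5 * (F * D)) (2 * (D * (F + D)))) (m*[n*n]≤1+n*n*n⇒m≤n 2≤y
      (≤-trans (right-product≥2DLy² (≰⇒> c≰1)) (right-product≤1+y³ unit)))

    bound-by-position : ∀ {x} → Position (F * y) (D * y) x → IsUnit (form x (+ y)) →
                        (5 * (F * D)) ⊓ (2 * (D * (F + D))) ≤ y
    bound-by-position (left a) unit =
      ⊥-elim (unit≢-product-cube {a} {a + F * y} {a + F * y + D * y} 2≤y
        (subst IsUnit (form-left (+ a) (+ (F * y)) (+ (D * y)) (+ y)) (on-roots (-ℤ (+ a)) unit)))
    bound-by-position (middle {c} {e} c+e≡Dy) unit =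
      ⊥-elim (unit≢-product-cube {c} {e} {F * y + c} 2≤y (subst IsUnit (form-middle (+ (F * y)) (+ c) (+ e) (+ y))
        (subst (λ w → IsUnit ((+ (F * y + c) - + (F * y)) *ℤ (+ (F * y + c) - + (F * y + w)) *ℤ + (F * y + c) - + y *ℤ + y *ℤ + y))
          (sym c+e≡Dy) (on-roots (+ (F * y + c)) unit))))
    bound-by-position (inner 0<a 0<b a+b≡Fy) unit = inner-bound 0<a 0<b a+b≡Fy unit
    bound-by-position (right 0<c) unit = right-bound 0<c unit

  y-bound : ∀ {x y} → 2 ≤ y → IsUnit (form x (+ y)) → (5 * (F * D)) ⊓ (2 * (D * (F + D))) ≤ y
  y-bound {x} {y} 2≤y = bound-by-position 2≤y (position (F * y) (D * y) x)

  ∣y∣-bound : ∀ {x y} → 2 ≤ ∣ y ∣ → IsUnit (form x y) → (5 * (F * D)) ⊓ (2 * (D * (F + D))) ≤ ∣ y ∣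
  ∣y∣-bound {x} {+ y}       2≤y unit = y-bound {x} 2≤y unit
  ∣y∣-bound {x} { -[1+ y ]} 2≤y unit = y-bound { -ℤ x} 2≤y (subst IsUnit (sym (thueForm-odd (+ F) (+ (F + D)) x -[1+ y ])) (IsUnit-neg unit))

lucas-suc : ∀ m → lucas (suc m) ≡ fib (suc m) + 2 * fib m
lucas-suc zero          = refl
lucas-suc (suc zero)    = refl
lucas-suc (suc (suc m)) = begin
  lucas (2 + m) + lucas (1 + m)                                ≡⟨ cong₂ _+_ (lucas-suc (suc m)) (lucas-suc m) ⟩
  (fib (2 + m) + 2 * fib (1 + m)) + (fib (1 + m) + 2 * fib m)  ≡⟨ regroup (fib (2 + m)) (fib (1 + m)) (fib m) ⟩
  (fib (2 + m) + fib (1 + m)) + 2 * (fib (1 + m) + fib m)      ∎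
  where
  open ≡-Reasoning
  regroup : ∀ a b c → (a + 2 * b) + (b + 2 * c) ≡ (a + b) + 2 * (b + c)
  regroup = ℕ-Ring.solve-∀

lucas≤⇒≥α^ : ∀ m {k} → lucas m * lucas m ≡ 5 * (fib m * fib m) + 4 → lucas m ≤ k → k ≥α^ m
lucas≤⇒≥α^ m {k} pell L≤k = L≤2k , (begin
  + (5 * (fib m * fib m))                   ≤⟨ +≤+ 5G²≤t² ⟩
  + (t * t)                                 ≡⟨ ℤₚ.pos-* t t ⟩
  + t *ℤ + t                                ≡⟨ cong₂ _*ℤ_ d≡t d≡t ⟨
  (+ (2 * k) - + L) *ℤ (+ (2 * k) - + L)    ∎)
  where
  open ℤₚ.≤-Reasoning
  L = lucas m
  L≤2k : L ≤ 2 * k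
  L≤2k = ≤-trans L≤k (m≤m+n k (k + 0))
  t = 2 * k ∸ L
  L+t≡2k : L + t ≡ 2 * k
  L+t≡2k = m+[n∸m]≡n L≤2k
  [l+t]-l≡t : ∀ l t → (l +ℤ t) - l ≡ t
  [l+t]-l≡t = ℤ-Ring.solve-∀
  d≡t : + (2 * k) - + L ≡ + t
  d≡t = trans (cong (λ n → + n - + L) (sym L+t≡2k)) ([l+t]-l≡t (+ L) (+ t))
  L≤t : L ≤ t
  L≤t = ≤-trans L≤k (+-cancelˡ-≤ L k t (≤-trans (+-monoˡ-≤ k L≤k)
          (≤-trans (≤-reflexive (cong (_+_ k) (sym (+-identityʳ k)))) (≤-reflexive (sym L+t≡2k)))))
  5G²≤t² : 5 * (fib m * fib m) ≤ t * t
  5G²≤t² = ≤-trans (m≤m+n _ 4) (≤-trans (≤-reflexive (sym pell)) (*-mono-≤ L≤t L≤t))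

-- `fib` and `lucas` take exponential time to evaluate; the finite check below runs on this linear iteration.
shift : ℕ × ℕ → ℕ × ℕ
shift (p , q) = q , q + p

iterate-recurrence : ℕ → ℕ → ℕ → ℕ × ℕ
iterate-recurrence s₀ s₁ zero    = s₀ , s₁
iterate-recurrence s₀ s₁ (suc m) = shift (iterate-recurrence s₀ s₁ m)

iterate-recurrence-correct : ∀ (s : ℕ → ℕ) → (∀ m → s (suc (suc m)) ≡ s (suc m) + s m) →
                             ∀ m → iterate-recurrence (s 0) (s 1) m ≡ (s m , s (suc m))
iterate-recurrence-correct s recurrence zero    = refl
iterate-recurrence-correct s recurrence (suc m) =
  trans (cong shift (iterate-recurrence-correct s recurrence m)) (cong (s (suc m) ,_) (sym (recurrence m)))

fastFib fastLucas : ℕ → ℕ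
fastFib   m = proj₁ (iterate-recurrence 0 1 m)
fastLucas m = proj₁ (iterate-recurrence 2 1 m)

fastFib≡fib : ∀ m → fastFib m ≡ fib m
fastFib≡fib m = cong proj₁ (iterate-recurrence-correct fib (λ _ → refl) m)

fastLucas≡lucas : ∀ m → fastLucas m ≡ lucas m
fastLucas≡lucas m = cong proj₁ (iterate-recurrence-correct lucas (λ _ → refl) m)

NumericFacts : ℕ → ℕ → ℕ → ℕ → Set
NumericFacts F D B G =
  F < D × 1 + 730 ^ 3 < F * F × B ≤ 5 * (F * D) × B ≤ 2 * (D * (F + D)) × B * B ≡ 5 * (G * G) + 4

numericFacts? : ∀ F D B G → Dec (NumericFacts F D B G)
numericFacts? F D B G =
  F <? D ×-dec 1 + 730 ^ 3 <? F * F ×-dec B ≤? 5 * (F * D) ×-dec B ≤? 2 * (D * (F + D)) ×-dec B * B ≟ 5 * (G * G) + 4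

NumericFacts-cong : ∀ {F F′ D D′ B B′ G G′} → F ≡ F′ → D ≡ D′ → B ≡ B′ → G ≡ G′ →
                    NumericFacts F D B G → NumericFacts F′ D′ B′ G′
NumericFacts-cong refl refl refl refl facts = facts

NumericFactsAt : ℕ → Set
NumericFactsAt n = NumericFacts (fib n) (2 * fib (pred n)) (lucas (2 * n)) (fib (2 * n))

fast⇒NumericFactsAt : ∀ n → NumericFacts (fastFib n) (2 * fastFib (pred n)) (fastLucas (2 * n)) (fastFib (2 * n)) → NumericFactsAt n
fast⇒NumericFactsAt n = NumericFacts-cong (fastFib≡fib n) (cong (2 *_) (fastFib≡fib (pred n))) (fastLucas≡lucas (2 * n)) (fastFib≡fib (2 * n))

interval-from-Fin : ∀ {P : ℕ → Set} lo k → (∀ (i : Fin k) → P (lo + toℕ i)) → ∀ n → lo ≤ n → n < lo + k → P n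
interval-from-Fin {P} lo k P-Fin n lo≤n n<lo+k with m≤n⇒∃[o]m+o≡n lo≤n
... | j , refl = subst (λ j → P (lo + j)) (toℕ-fromℕ< j<k) (P-Fin (fromℕ< j<k))
  where
  j<k : j < k
  j<k = +-cancelˡ-< lo j k n<lo+k

numericFacts : ∀ n → 49 ≤ n → n ≤ 132 → NumericFactsAt n
numericFacts n 49≤n n≤132 = interval-from-Fin {NumericFactsAt} 49 84 checked n 49≤n (s≤s n≤132)
  where
  fastFacts? : ∀ n → Dec (NumericFacts (fastFib n) (2 * fastFib (pred n)) (fastLucas (2 * n)) (fastFib (2 * n)))
  fastFacts? n = numericFacts? (fastFib n) (2 * fastFib (pred n)) (fastLucas (2 * n)) (fastFib (2 * n))
  checked : ∀ (i : Fin 84) → NumericFactsAt (49 + toℕ i)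
  checked i = fast⇒NumericFactsAt (49 + toℕ i) (toWitness {a? = all? λ j → fastFacts? (49 + toℕ j)} _ i)

lemma5p1 : (n : ℕ) → 49 ≤ n → n ≤ 132 → (x y : ℤ) →
    ((x - (+ fib n) *ℤ y) *ℤ (x - (+ lucas n) *ℤ y) *ℤ x - y *ℤ y *ℤ y ≡ + 1
    ⊎ (x - (+ fib n) *ℤ y) *ℤ (x - (+ lucas n) *ℤ y) *ℤ x - y *ℤ y *ℤ y ≡ -ℤ (+ 1)) →
    2 ≤ ∣ y ∣ →
    ∣ y ∣ ≥α^ (2 * n)
lemma5p1 zero ()
lemma5p1 n@(suc m) 49≤n n≤132 x y unit 2≤∣y∣ =
  let F<D , 1+730³<F² , B≤5FD , B≤2DL , pell = numericFacts n 49≤n n≤132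
      unit′ = subst (λ L → IsUnit (thueForm (+ fib n) (+ L) x y)) (lucas-suc m) unit
  in lucas≤⇒≥α^ (2 * n) pell (≤-trans (⊓-glb B≤5FD B≤2DL) (∣y∣-bound F<D 1+730³<F² {x} {y} 2≤∣y∣ unit′))
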